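{- Let $G$ be a non-regular graph on $n$ vertices and let $u,v$ be vertices of $G$ with $d_G(u)<d_G(v)$. If $F_k(G)$ is regular for some $2\le k\le n-2$, then $v$ is adjacent in $G$ to every vertex of $V(G)\setminus\{u,v\}$.
   Context: All graphs are finite and simple; $d_G(w)$ is the degree of $w$ in $G$. For a graph $G=(V,E)$ on $n$ vertices and $1\le k<n$, the $k$-token graph $F_k(G)$ has as vertices the $k$-element subsets of $V$, with $A,B$ adjacent whenever $A\triangle B=\{a,b\}$ for some edge $ab$ of $G$. -}

module Defs where

open import Data.Nat using (ℕ; zero; suc; _≤_; _<_; _∸_)
open import Data.Bool using (Bool; true; false; _∧_; _∨_; _xor_; not; if_then_else_)
open import Data.Fin using (Fin; _≟_)
open import Data.List using (List; []; _∷_; map; _++_; allFin; length; filter)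
open import Data.Vec using (Vec; []; _∷_; lookup)
open import Data.Product using (∃; _×_; _,_)
open import Relation.Binary.PropositionalEquality using (_≡_; _≢_)
open import Relation.Nullary.Decidable using (⌊_⌋)

record Graph (n : ℕ) : Set where
  field
    adj   : Fin n → Fin n → Bool
    sym   : ∀ a b → adj a b ≡ adj b a
    irrefl : ∀ a → adj a a ≡ false
open Graph public

countL : {A : Set} → (A → Bool) → List A → ℕ
countL p [] = 0
countL p (x ∷ xs) = if p x then suc (countL p xs) else countL p xs

deg : ∀ {n} → Graph n → Fin n → ℕ
deg G w = countL (adj G w) (allFin _)

Regular : ∀ {n} → Graph n → Set
Regular G = ∃ λ r → ∀ w → deg G w ≡ r

-- subsets of Fin n as characteristic Boolean vectors
Sub : ℕ → Set
Sub n = Vec Bool n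

allSubs : (n : ℕ) → List (Sub n)
allSubs zero = [] ∷ []
allSubs (suc n) = map (true ∷_) (allSubs n) ++ map (false ∷_) (allSubs n)

size : ∀ {n} → Sub n → ℕ
size [] = 0
size (true ∷ A) = suc (size A)
size (false ∷ A) = size A

eqF : ∀ {n} → Fin n → Fin n → Bool
eqF a b = ⌊ a ≟ b ⌋

eqℕ : ℕ → ℕ → Bool
eqℕ m n = ⌊ m Data.Nat.≟ n ⌋

_==ᵇ_ : Bool → Bool → Bool
true ==ᵇ y = y
false ==ᵇ y = not y

anyL allL : {A : Set} → (A → Bool) → List A → Bool
anyL p [] = false
anyL p (x ∷ xs) = p x ∨ anyL p xs
allL p [] = true
allL p (x ∷ xs) = p x ∧ allL p xs

-- adjacency in the k-token graph: A △ B = {a , b} for some edge ab of G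
tokAdj : ∀ {n} → Graph n → Sub n → Sub n → Bool
tokAdj {n} G A B =
  anyL (λ a → anyL (λ b → adj G a b ∧
         allL (λ x → (lookup A x xor lookup B x) ==ᵇ (eqF x a ∨ eqF x b)) (allFin n))
       (allFin n)) (allFin n)

tokDeg : ∀ {n} → Graph n → ℕ → Sub n → ℕ
tokDeg {n} G k A = countL (λ B → eqℕ (size B) k ∧ tokAdj G A B) (allSubs n)

TokenRegular : ∀ {n} → Graph n → ℕ → Set
TokenRegular {n} G k = ∃ λ r → ∀ (A : Sub n) → size A ≡ k → tokDeg G k A ≡ r

-- The degree of a k-set A in F_k(G) is the number of edges of G leaving A. Adding a vertex
-- x ∉ S to S changes this number by deg x − 2|N(x) ∩ S|, so when F_k(G) is regular,
-- deg u + 2|N(v) ∩ S| = deg v + 2|N(u) ∩ S| for every (k−1)-set S avoiding u and v.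
-- If every neighbour of v outside {u, v} were a neighbour of u, this would give deg v ≤ deg u;
-- so some z ∉ {u, v} is adjacent to v but not to u. Comparing the identity for S = T ∪ {w}
-- and S = T ∪ {z}, with T a (k−2)-set avoiding u, v, w and z, gives
-- [vw] − [uw] = [vz] − [uz] = 1, hence vw is an edge.

module Submission where

open import Defs hiding (sym)
open import Data.Nat using (ℕ; zero; suc; _+_; _*_; _<_; _≤_; _∸_; z≤n; s≤s)
open import Data.Nat.Properties
open import Data.Nat.Tactic.RingSolver using (solve-∀)
open import Data.Fin using (Fin; zero; suc)
import Data.Fin.Properties as Fin
open import Data.Bool using (Bool; true; false; _∧_; _∨_; not; _xor_; if_then_else_)
open import Data.Bool.Properties
  using (∧-comm; ∧-zeroʳ; ∧-identityʳ; ∨-identityʳ; ∨-idem; xor-assoc; xor-same) renaming (_≟_ to _≟ᵇ_)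
open import Data.List using (List; []; _∷_; map; _++_; tabulate; length)
open import Data.List.Relation.Unary.All using (All; []; _∷_)
import Data.List.Relation.Unary.All as All
open import Data.Vec using ([]; _∷_; lookup; zipWith; _[_]≔_)
open import Data.Fin.Subset using (⁅_⁆; ⊤) renaming (⊥ to ∅)
open import Data.Vec.Properties using (lookup-zipWith; lookup∘update; lookup∘update′)
open import Data.Product using (∃; _×_; _,_)
open import Data.Empty using (⊥-elim)
open import Function using (_∘_; id)
open import Relation.Nullary using (¬_; yes; no; ¬?; _×-dec_)
open import Relation.Nullary.Decidable using (isYes≗does; dec-true; dec-false; ⌊⌋-map′)
open import Relation.Binary.PropositionalEquality
open import Algebra.Properties.CommutativeMonoid.Sum +-0-commutativeMonoid
  using (sum; sum-syntax; sum-replicate-zero; ∑-distrib-+; sum-cong-≗)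
open import Algebra.Properties.CommutativeSemigroup +-commutativeSemigroup using (xy∙z≈xz∙y; xy∙z≈zx∙y)

⟦_⟧ : Bool → ℕ
⟦ b ⟧ = if b then 1 else 0

eqF-suc : ∀ {n} (x y : Fin n) → eqF (suc x) (suc y) ≡ eqF x y
eqF-suc x y = ⌊⌋-map′ _ _ (x Fin.≟ y)

eqℕ-refl : ∀ m → eqℕ m m ≡ true
eqℕ-refl m = trans (isYes≗does (m Data.Nat.≟ m)) (dec-true (m Data.Nat.≟ m) refl)

eqℕ-≢ : ∀ {m n} → m ≢ n → eqℕ m n ≡ false
eqℕ-≢ {m} {n} m≢n = trans (isYes≗does (m Data.Nat.≟ n)) (dec-false (m Data.Nat.≟ n) m≢n)

eqℕ-suc : ∀ m n → eqℕ (suc m) (suc n) ≡ eqℕ m n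
eqℕ-suc m n = trans (⌊⌋-map′ _ _ _) (sym (⌊⌋-map′ _ _ _))

∑-mono-≤ : ∀ {n} {f g : Fin n → ℕ} → (∀ i → f i ≤ g i) → sum f ≤ sum g
∑-mono-≤ {zero} f≤g = z≤n
∑-mono-≤ {suc n} f≤g = +-mono-≤ (f≤g zero) (∑-mono-≤ (f≤g ∘ suc))

∑-point : ∀ {n} (x : Fin n) (c : ℕ) → ∑[ i < n ] (if eqF i x then c else 0) ≡ c
∑-point {suc n} zero c = trans (cong (c +_) (sum-replicate-zero n)) (+-identityʳ c)
∑-point {suc n} (suc x) c = trans (sum-cong-≗ λ i → cong (if_then c else 0) (eqF-suc i x)) (∑-point x c)

countL-++ : ∀ {A : Set} (p : A → Bool) xs ys → countL p (xs ++ ys) ≡ countL p xs + countL p ys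
countL-++ p [] ys = refl
countL-++ p (x ∷ xs) ys with p x
... | true = cong suc (countL-++ p xs ys)
... | false = countL-++ p xs ys

countL-map : ∀ {A B : Set} (p : B → Bool) (f : A → B) xs → countL p (map f xs) ≡ countL (p ∘ f) xs
countL-map p f [] = refl
countL-map p f (x ∷ xs) with p (f x)
... | true = cong suc (countL-map p f xs)
... | false = countL-map p f xs

countL-cong : ∀ {A : Set} {p q : A → Bool} → (∀ x → p x ≡ q x) → ∀ xs → countL p xs ≡ countL q xs
countL-cong p≗q [] = refl
countL-cong {q = q} p≗q (x ∷ xs) rewrite p≗q x with q x
... | true = cong suc (countL-cong p≗q xs)
... | false = countL-cong p≗q xs

countL-false : ∀ {A : Set} (xs : List A) → countL (λ _ → false) xs ≡ 0
countL-false [] = refl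
countL-false (x ∷ xs) = countL-false xs

countL-tabulate : ∀ {A : Set} {n} (p : A → Bool) (f : Fin n → A) →
  countL p (tabulate f) ≡ ∑[ i < n ] ⟦ p (f i) ⟧
countL-tabulate {n = zero} p f = refl
countL-tabulate {n = suc n} p f with p (f zero)
... | true = cong suc (countL-tabulate p (f ∘ suc))
... | false = countL-tabulate p (f ∘ suc)

countL-allSubs-suc : ∀ n (P : Sub (suc n) → Bool) → countL P (allSubs (suc n)) ≡
  countL (P ∘ (true ∷_)) (allSubs n) + countL (P ∘ (false ∷_)) (allSubs n)
countL-allSubs-suc n P = trans (countL-++ P (map (true ∷_) (allSubs n)) (map (false ∷_) (allSubs n)))
  (cong₂ _+_ (countL-map P (true ∷_) (allSubs n)) (countL-map P (false ∷_) (allSubs n)))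

-- Symmetric difference

infixl 6 _⊕_
_⊕_ : ∀ {n} → Sub n → Sub n → Sub n
_⊕_ = zipWith _xor_

lookup-⊕-cancel : ∀ {n} (A D : Sub n) x → lookup A x xor lookup (A ⊕ D) x ≡ lookup D x
lookup-⊕-cancel A D x = begin
  lookup A x xor lookup (A ⊕ D) x          ≡⟨ cong (lookup A x xor_) (lookup-zipWith _xor_ x A D) ⟩
  lookup A x xor (lookup A x xor lookup D x) ≡⟨ sym (xor-assoc (lookup A x) (lookup A x) (lookup D x)) ⟩
  (lookup A x xor lookup A x) xor lookup D x ≡⟨ cong (_xor lookup D x) (xor-same (lookup A x)) ⟩
  lookup D x                                ∎
  where open ≡-Reasoning

⊕-identityʳ : ∀ {n} (A : Sub n) → A ⊕ ∅ ≡ A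
⊕-identityʳ [] = refl
⊕-identityʳ (true ∷ A) = cong (true ∷_) (⊕-identityʳ A)
⊕-identityʳ (false ∷ A) = cong (false ∷_) (⊕-identityʳ A)

size-⊕-⁅⁆-∉ : ∀ {n} (A : Sub n) b → lookup A b ≡ false → size (A ⊕ ⁅ b ⁆) ≡ suc (size A)
size-⊕-⁅⁆-∉ (false ∷ A) zero _ = cong (suc ∘ size) (⊕-identityʳ A)
size-⊕-⁅⁆-∉ (true ∷ A) (suc b) b∉A = cong suc (size-⊕-⁅⁆-∉ A b b∉A)
size-⊕-⁅⁆-∉ (false ∷ A) (suc b) b∉A = size-⊕-⁅⁆-∉ A b b∉A

size-⊕-⁅⁆-∈ : ∀ {n} (A : Sub n) b → lookup A b ≡ true → suc (size (A ⊕ ⁅ b ⁆)) ≡ size A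
size-⊕-⁅⁆-∈ (true ∷ A) zero _ = cong (suc ∘ size) (⊕-identityʳ A)
size-⊕-⁅⁆-∈ (true ∷ A) (suc b) b∈A = cong suc (size-⊕-⁅⁆-∈ A b b∈A)
size-⊕-⁅⁆-∈ (false ∷ A) (suc b) b∈A = size-⊕-⁅⁆-∈ A b b∈A

m≢2+m : ∀ m → m ≢ suc (suc m)
m≢2+m m = <⇒≢ (m<n⇒m<1+n (n<1+n m))

grows-by-⊕-⁅⁆ : ∀ {n} (A : Sub n) b → eqℕ (size (A ⊕ ⁅ b ⁆)) (suc (size A)) ≡ not (lookup A b)
grows-by-⊕-⁅⁆ A b with lookup A b in b∈A
... | false rewrite size-⊕-⁅⁆-∉ A b b∈A = eqℕ-refl _
... | true = eqℕ-≢ λ grows → m≢2+m _ (trans grows (cong suc (sym (size-⊕-⁅⁆-∈ A b b∈A))))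

shrinks-by-⊕-⁅⁆ : ∀ {n} (A : Sub n) b → eqℕ (suc (size (A ⊕ ⁅ b ⁆))) (size A) ≡ lookup A b
shrinks-by-⊕-⁅⁆ A b with lookup A b in b∈A
... | true rewrite size-⊕-⁅⁆-∈ A b b∈A = eqℕ-refl _
... | false = eqℕ-≢ λ shrinks → m≢2+m _ (trans (sym shrinks) (cong suc (size-⊕-⁅⁆-∉ A b b∈A)))

countL-allSubs-⊕ : ∀ {n} (A : Sub n) (P : Sub n → Bool) →
  countL P (allSubs n) ≡ countL (λ D → P (A ⊕ D)) (allSubs n)
countL-allSubs-⊕ [] P = refl
countL-allSubs-⊕ {suc n} (a ∷ A) P = begin
  countL P (allSubs (suc n))  ≡⟨ countL-allSubs-suc n P ⟩
  c true + c false            ≡⟨ cong₂ _+_ (countL-allSubs-⊕ A (P ∘ (true ∷_)))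
                                             (countL-allSubs-⊕ A (P ∘ (false ∷_))) ⟩
  c⊕ true + c⊕ false          ≡⟨ swap a ⟩
  c⊕ (a xor true) + c⊕ (a xor false) ≡⟨ sym (countL-allSubs-suc n (λ D → P ((a ∷ A) ⊕ D))) ⟩
  countL (λ D → P ((a ∷ A) ⊕ D)) (allSubs (suc n)) ∎
  where
  open ≡-Reasoning
  c c⊕ : Bool → ℕ
  c b = countL (λ D → P (b ∷ D)) (allSubs n)
  c⊕ b = countL (λ D → P (b ∷ (A ⊕ D))) (allSubs n)
  swap : ∀ a → c⊕ true + c⊕ false ≡ c⊕ (a xor true) + c⊕ (a xor false)
  swap true = +-comm (c⊕ true) (c⊕ false)
  swap false = refl

-- Edges of G as vertex sets

anyᶠ allᶠ : ∀ {n} → (Fin n → Bool) → Bool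
anyᶠ {zero} p = false
anyᶠ {suc n} p = p zero ∨ anyᶠ (p ∘ suc)
allᶠ {zero} p = true
allᶠ {suc n} p = p zero ∧ allᶠ (p ∘ suc)

anyL-tabulate : ∀ {A : Set} {n} (p : A → Bool) (f : Fin n → A) → anyL p (tabulate f) ≡ anyᶠ (p ∘ f)
anyL-tabulate {n = zero} p f = refl
anyL-tabulate {n = suc n} p f = cong (p (f zero) ∨_) (anyL-tabulate p (f ∘ suc))

allL-tabulate : ∀ {A : Set} {n} (p : A → Bool) (f : Fin n → A) → allL p (tabulate f) ≡ allᶠ (p ∘ f)
allL-tabulate {n = zero} p f = refl
allL-tabulate {n = suc n} p f = cong (p (f zero) ∧_) (allL-tabulate p (f ∘ suc))

anyᶠ-cong : ∀ {n} {p q : Fin n → Bool} → (∀ i → p i ≡ q i) → anyᶠ p ≡ anyᶠ q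
anyᶠ-cong {zero} p≗q = refl
anyᶠ-cong {suc n} p≗q = cong₂ _∨_ (p≗q zero) (anyᶠ-cong (p≗q ∘ suc))

allᶠ-cong : ∀ {n} {p q : Fin n → Bool} → (∀ i → p i ≡ q i) → allᶠ p ≡ allᶠ q
allᶠ-cong {zero} p≗q = refl
allᶠ-cong {suc n} p≗q = cong₂ _∧_ (p≗q zero) (allᶠ-cong (p≗q ∘ suc))

anyᶠ-∧-false : ∀ {n} (p : Fin n → Bool) → anyᶠ (λ i → p i ∧ false) ≡ false
anyᶠ-∧-false {zero} p = refl
anyᶠ-∧-false {suc n} p = cong₂ _∨_ (∧-zeroʳ (p zero)) (anyᶠ-∧-false (p ∘ suc))

isSingleton : ∀ {n} → Sub n → Fin n → Bool
isSingleton D b = allᶠ (λ x → lookup D x ==ᵇ eqF x b)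

isPair : ∀ {n} → Sub n → Fin n → Fin n → Bool
isPair D a b = allᶠ (λ x → lookup D x ==ᵇ (eqF x a ∨ eqF x b))

isEmpty : ∀ {n} → Sub n → Bool
isEmpty [] = true
isEmpty (true ∷ D) = false
isEmpty (false ∷ D) = isEmpty D

-- Recursive forms of "D = {b} with p b" and "D is an edge of G", suited to induction over allSubs.
isSingletonIn : ∀ {n} → (Fin n → Bool) → Sub n → Bool
isSingletonIn p [] = false
isSingletonIn p (true ∷ D) = p zero ∧ isEmpty D
isSingletonIn p (false ∷ D) = isSingletonIn (p ∘ suc) D

removeZero : ∀ {n} → Graph (suc n) → Graph n
removeZero G = record
  { adj = λ a b → adj G (suc a) (suc b)
  ; sym = λ a b → Graph.sym G (suc a) (suc b)
  ; irrefl = λ a → irrefl G (suc a)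
  }

isEdge : ∀ {n} → Graph n → Sub n → Bool
isEdge G [] = false
isEdge G (true ∷ D) = isSingletonIn (adj G zero ∘ suc) D
isEdge G (false ∷ D) = isEdge (removeZero G) D

allᶠ-isEmpty : ∀ {n} (D : Sub n) → allᶠ (λ x → lookup D x ==ᵇ false) ≡ isEmpty D
allᶠ-isEmpty [] = refl
allᶠ-isEmpty (true ∷ D) = refl
allᶠ-isEmpty (false ∷ D) = allᶠ-isEmpty D

anyᶠ-isSingleton : ∀ {n} (p : Fin n → Bool) (D : Sub n) →
  anyᶠ (λ b → p b ∧ isSingleton D b) ≡ isSingletonIn p D
anyᶠ-isSingleton p [] = refl
anyᶠ-isSingleton p (true ∷ D) = begin
  (p zero ∧ allᶠ (λ x → lookup D x ==ᵇ false)) ∨ anyᶠ (λ b → p (suc b) ∧ false)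
    ≡⟨ cong₂ _∨_ (cong (p zero ∧_) (allᶠ-isEmpty D)) (anyᶠ-∧-false (p ∘ suc)) ⟩
  (p zero ∧ isEmpty D) ∨ false ≡⟨ ∨-identityʳ _ ⟩
  p zero ∧ isEmpty D ∎
  where open ≡-Reasoning
anyᶠ-isSingleton p (false ∷ D) = begin
  (p zero ∧ false) ∨ anyᶠ (λ b → p (suc b) ∧ allᶠ (λ x → lookup D x ==ᵇ eqF (suc x) (suc b)))
    ≡⟨ cong₂ _∨_ (∧-zeroʳ (p zero)) (anyᶠ-cong λ b → cong (p (suc b) ∧_) (allᶠ-cong λ x →
         cong (lookup D x ==ᵇ_) (eqF-suc x b))) ⟩
  anyᶠ (λ b → p (suc b) ∧ isSingleton D b) ≡⟨ anyᶠ-isSingleton (p ∘ suc) D ⟩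
  isSingletonIn (p ∘ suc) D ∎
  where open ≡-Reasoning

anyᶠ-isPair : ∀ {n} (G : Graph n) (D : Sub n) →
  anyᶠ (λ a → anyᶠ (λ b → adj G a b ∧ isPair D a b)) ≡ isEdge G D
anyᶠ-isPair G [] = refl
anyᶠ-isPair G (true ∷ D) = begin
  ((adj G zero zero ∧ _) ∨ anyᶠ (λ b → adj G zero (suc b) ∧ isPair (true ∷ D) zero (suc b)))
    ∨ anyᶠ (λ a → (adj G (suc a) zero ∧ isPair (true ∷ D) (suc a) zero)
                  ∨ anyᶠ (λ b → adj G (suc a) (suc b) ∧ false))
    ≡⟨ cong₂ _∨_ from-zero to-zero ⟩
  X ∨ X ≡⟨ ∨-idem X ⟩
  X ≡⟨ anyᶠ-isSingleton (adj G zero ∘ suc) D ⟩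
  isSingletonIn (adj G zero ∘ suc) D ∎
  where
  open ≡-Reasoning
  X : Bool
  X = anyᶠ (λ b → adj G zero (suc b) ∧ isSingleton D b)
  isPair-suc : ∀ a → isPair (true ∷ D) zero (suc a) ≡ isSingleton D a
  isPair-suc a = allᶠ-cong λ x → cong (lookup D x ==ᵇ_) (eqF-suc x a)
  from-zero : (adj G zero zero ∧ isPair (true ∷ D) zero zero)
                ∨ anyᶠ (λ b → adj G zero (suc b) ∧ isPair (true ∷ D) zero (suc b)) ≡ X
  from-zero rewrite irrefl G zero = anyᶠ-cong λ b → cong (adj G zero (suc b) ∧_) (isPair-suc b)
  to-zero : anyᶠ (λ a → (adj G (suc a) zero ∧ isPair (true ∷ D) (suc a) zero)
                        ∨ anyᶠ (λ b → adj G (suc a) (suc b) ∧ false)) ≡ X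
  to-zero = anyᶠ-cong λ a → begin
    (adj G (suc a) zero ∧ isPair (true ∷ D) (suc a) zero) ∨ anyᶠ (λ b → adj G (suc a) (suc b) ∧ false)
      ≡⟨ cong₂ _∨_ (cong₂ _∧_ (Graph.sym G (suc a) zero)
           (allᶠ-cong λ x → cong (lookup D x ==ᵇ_) (∨-identityʳ (eqF (suc x) (suc a)))))
           (anyᶠ-∧-false (adj G (suc a) ∘ suc)) ⟩
    (adj G zero (suc a) ∧ isPair (true ∷ D) zero (suc a)) ∨ false
      ≡⟨ ∨-identityʳ _ ⟩
    adj G zero (suc a) ∧ isPair (true ∷ D) zero (suc a)
      ≡⟨ cong (adj G zero (suc a) ∧_) (isPair-suc a) ⟩
    adj G zero (suc a) ∧ isSingleton D a ∎
anyᶠ-isPair G (false ∷ D) = begin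
  ((adj G zero zero ∧ false) ∨ anyᶠ (λ b → adj G zero (suc b) ∧ false))
    ∨ anyᶠ (λ a → (adj G (suc a) zero ∧ false)
                  ∨ anyᶠ (λ b → adj G (suc a) (suc b) ∧ isPair (false ∷ D) (suc a) (suc b)))
    ≡⟨ cong₂ _∨_ (cong₂ _∨_ (∧-zeroʳ _) (anyᶠ-∧-false (adj G zero ∘ suc)))
         (anyᶠ-cong λ a → cong₂ _∨_ (∧-zeroʳ _) (anyᶠ-cong λ b → cong (adj G (suc a) (suc b) ∧_)
           (allᶠ-cong λ x → cong (lookup D x ==ᵇ_) (cong₂ _∨_ (eqF-suc x a) (eqF-suc x b))))) ⟩
  anyᶠ (λ a → anyᶠ (λ b → adj (removeZero G) a b ∧ isPair D a b))
    ≡⟨ anyᶠ-isPair (removeZero G) D ⟩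
  isEdge (removeZero G) D ∎
  where open ≡-Reasoning

tokAdj-⊕ : ∀ {n} (G : Graph n) (A D : Sub n) → tokAdj G A (A ⊕ D) ≡ isEdge G D
tokAdj-⊕ {n} G A D = begin
  tokAdj G A (A ⊕ D)
    ≡⟨ trans (anyL-tabulate {n = n} _ id) (anyᶠ-cong λ a → trans (anyL-tabulate {n = n} _ id) (anyᶠ-cong λ b →
         cong (adj G a b ∧_) (trans (allL-tabulate {n = n} _ id) (allᶠ-cong λ x →
           cong (_==ᵇ (eqF x a ∨ eqF x b)) (lookup-⊕-cancel A D x))))) ⟩
  anyᶠ (λ a → anyᶠ (λ b → adj G a b ∧ isPair D a b)) ≡⟨ anyᶠ-isPair G D ⟩
  isEdge G D ∎
  where open ≡-Reasoning

countL-isEmpty : ∀ {n} (q : Sub n → Bool) → countL (λ D → isEmpty D ∧ q D) (allSubs n) ≡ ⟦ q ∅ ⟧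
countL-isEmpty {zero} q = refl
countL-isEmpty {suc n} q = begin
  countL (λ D → isEmpty D ∧ q D) (allSubs (suc n))
    ≡⟨ countL-allSubs-suc n (λ D → isEmpty D ∧ q D) ⟩
  countL (λ _ → false) (allSubs n) + countL (λ D → isEmpty D ∧ q (false ∷ D)) (allSubs n)
    ≡⟨ cong₂ _+_ (countL-false (allSubs n)) (countL-isEmpty (q ∘ (false ∷_))) ⟩
  ⟦ q ∅ ⟧ ∎
  where open ≡-Reasoning

countL-isSingletonIn : ∀ {n} (p : Fin n → Bool) (q : Sub n → Bool) →
  countL (λ D → isSingletonIn p D ∧ q D) (allSubs n) ≡ ∑[ b < n ] ⟦ q ⁅ b ⁆ ∧ p b ⟧
countL-isSingletonIn {zero} p q = refl
countL-isSingletonIn {suc n} p q =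
  trans (countL-allSubs-suc n (λ D → isSingletonIn p D ∧ q D))
    (cong₂ _+_ (at-zero (p zero)) (countL-isSingletonIn (p ∘ suc) (q ∘ (false ∷_))))
  where
  at-zero : ∀ p₀ → countL (λ D → (p₀ ∧ isEmpty D) ∧ q (true ∷ D)) (allSubs n) ≡ ⟦ q ⁅ zero ⁆ ∧ p₀ ⟧
  at-zero true = trans (countL-isEmpty (q ∘ (true ∷_))) (cong ⟦_⟧ (sym (∧-identityʳ _)))
  at-zero false = trans (countL-false (allSubs n)) (cong ⟦_⟧ (sym (∧-zeroʳ _)))

-- Degrees in the token graph

degIn degOut : ∀ {n} → Graph n → Sub n → Fin n → ℕ
degIn {n} G A x = ∑[ b < n ] ⟦ lookup A b ∧ adj G x b ⟧
degOut {n} G A x = ∑[ b < n ] ⟦ not (lookup A b) ∧ adj G x b ⟧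

cut : ∀ {n} → Graph n → Sub n → ℕ
cut {n} G A = ∑[ a < n ] (if lookup A a then degOut G A a else 0)

countL-isEdge : ∀ {n} (G : Graph n) (A : Sub n) →
  countL (λ D → isEdge G D ∧ eqℕ (size (A ⊕ D)) (size A)) (allSubs n) ≡ cut G A
countL-isEdge G [] = refl
countL-isEdge {suc n} G (true ∷ A) = begin
  countL (λ D → isEdge G D ∧ eqℕ (size ((true ∷ A) ⊕ D)) (suc (size A))) (allSubs (suc n))
    ≡⟨ countL-allSubs-suc n _ ⟩
  countL (λ D → isSingletonIn (adj G zero ∘ suc) D ∧ eqℕ (size (A ⊕ D)) (suc (size A))) (allSubs n)
    + countL (λ D → isEdge (removeZero G) D ∧ eqℕ (suc (size (A ⊕ D))) (suc (size A))) (allSubs n)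
    ≡⟨ cong₂ _+_ (countL-isSingletonIn (adj G zero ∘ suc) (λ D → eqℕ (size (A ⊕ D)) (suc (size A))))
         (countL-cong (λ D → cong (isEdge (removeZero G) D ∧_) (eqℕ-suc _ _)) (allSubs n)) ⟩
  ∑[ b < n ] ⟦ eqℕ (size (A ⊕ ⁅ b ⁆)) (suc (size A)) ∧ adj G zero (suc b) ⟧
    + countL (λ D → isEdge (removeZero G) D ∧ eqℕ (size (A ⊕ D)) (size A)) (allSubs n)
    ≡⟨ cong₂ _+_ (sum-cong-≗ {n} λ b → cong (λ t → ⟦ t ∧ adj G zero (suc b) ⟧) (grows-by-⊕-⁅⁆ A b))
         (countL-isEdge (removeZero G) A) ⟩
  cut G (true ∷ A) ∎
  where open ≡-Reasoning
countL-isEdge {suc n} G (false ∷ A) = begin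
  countL (λ D → isEdge G D ∧ eqℕ (size ((false ∷ A) ⊕ D)) (size A)) (allSubs (suc n))
    ≡⟨ countL-allSubs-suc n _ ⟩
  countL (λ D → isSingletonIn (adj G zero ∘ suc) D ∧ eqℕ (suc (size (A ⊕ D))) (size A)) (allSubs n)
    + countL (λ D → isEdge (removeZero G) D ∧ eqℕ (size (A ⊕ D)) (size A)) (allSubs n)
    ≡⟨ cong₂ _+_ (countL-isSingletonIn (adj G zero ∘ suc) (λ D → eqℕ (suc (size (A ⊕ D))) (size A)))
         (countL-isEdge (removeZero G) A) ⟩
  ∑[ b < n ] ⟦ eqℕ (suc (size (A ⊕ ⁅ b ⁆))) (size A) ∧ adj G zero (suc b) ⟧ + cut (removeZero G) A
    ≡⟨ cong (_+ cut (removeZero G) A)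
         (sum-cong-≗ {n} λ b → cong (λ t → ⟦ t ∧ adj G zero (suc b) ⟧) (shrinks-by-⊕-⁅⁆ A b)) ⟩
  ∑[ b < n ] ⟦ lookup A b ∧ adj G zero (suc b) ⟧ + cut (removeZero G) A
    ≡⟨ sym (∑-distrib-+ {n} _ _) ⟩
  ∑[ a < n ] (⟦ lookup A a ∧ adj G zero (suc a) ⟧ + (if lookup A a then degOut (removeZero G) A a else 0))
    ≡⟨ sum-cong-≗ {n} (λ a → edge-to-zero a (lookup A a)) ⟩
  cut G (false ∷ A) ∎
  where
  open ≡-Reasoning
  edge-to-zero : ∀ a a∈A → ⟦ a∈A ∧ adj G zero (suc a) ⟧ + (if a∈A then degOut (removeZero G) A a else 0)
                           ≡ (if a∈A then ⟦ adj G (suc a) zero ⟧ + degOut (removeZero G) A a else 0)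
  edge-to-zero a true = cong (λ t → ⟦ t ⟧ + degOut (removeZero G) A a) (Graph.sym G zero (suc a))
  edge-to-zero a false = refl

-- B ↦ A ⊕ B turns the neighbours of A in the token graph into the edges D of G with |A ⊕ D| = |A|.
tokDeg≡cut : ∀ {n} (G : Graph n) (A : Sub n) → tokDeg G (size A) A ≡ cut G A
tokDeg≡cut {n} G A = begin
  tokDeg G (size A) A
    ≡⟨ countL-allSubs-⊕ A _ ⟩
  countL (λ D → sameSize D ∧ tokAdj G A (A ⊕ D)) (allSubs n)
    ≡⟨ countL-cong (λ D → trans (∧-comm (sameSize D) _) (cong (_∧ sameSize D) (tokAdj-⊕ G A D))) (allSubs n) ⟩
  countL (λ D → isEdge G D ∧ sameSize D) (allSubs n)
    ≡⟨ countL-isEdge G A ⟩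
  cut G A ∎
  where
  open ≡-Reasoning
  sameSize : Sub n → Bool
  sameSize D = eqℕ (size (A ⊕ D)) (size A)

size-insert : ∀ {n} (A : Sub n) x → lookup A x ≡ false → size (A [ x ]≔ true) ≡ suc (size A)
size-insert (false ∷ A) zero _ = refl
size-insert (true ∷ A) (suc x) x∉A = cong suc (size-insert A x x∉A)
size-insert (false ∷ A) (suc x) x∉A = size-insert A x x∉A

∑-insert : ∀ {n} (A : Sub n) y → lookup A y ≡ false → (f : Fin n → Bool → ℕ) →
  ∑[ b < n ] f b (lookup (A [ y ]≔ true) b) + f y false ≡ f y true + ∑[ b < n ] f b (lookup A b)
∑-insert {n} A y y∉A f = begin
  ∑[ b < n ] f b (lookup (A [ y ]≔ true) b) + f y false
    ≡⟨ cong (∑[ b < n ] f b (lookup (A [ y ]≔ true) b) +_) (sym (∑-point y (f y false))) ⟩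
  ∑[ b < n ] f b (lookup (A [ y ]≔ true) b) + ∑[ b < n ] (if eqF b y then f y false else 0)
    ≡⟨ sym (∑-distrib-+ {n} _ _) ⟩
  ∑[ b < n ] (f b (lookup (A [ y ]≔ true) b) + (if eqF b y then f y false else 0))
    ≡⟨ sum-cong-≗ {n} move ⟩
  ∑[ b < n ] ((if eqF b y then f y true else 0) + f b (lookup A b))
    ≡⟨ ∑-distrib-+ {n} _ _ ⟩
  ∑[ b < n ] (if eqF b y then f y true else 0) + ∑[ b < n ] f b (lookup A b)
    ≡⟨ cong (_+ ∑[ b < n ] f b (lookup A b)) (∑-point y (f y true)) ⟩
  f y true + ∑[ b < n ] f b (lookup A b) ∎
  where
  open ≡-Reasoning
  move : ∀ b → f b (lookup (A [ y ]≔ true) b) + (if eqF b y then f y false else 0)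
             ≡ (if eqF b y then f y true else 0) + f b (lookup A b)
  move b with b Fin.≟ y
  ... | yes refl rewrite lookup∘update y A true | y∉A = refl
  ... | no b≢y rewrite lookup∘update′ b≢y A true = +-identityʳ _

degIn-insert : ∀ {n} (G : Graph n) (A : Sub n) x y → lookup A y ≡ false →
  degIn G (A [ y ]≔ true) x ≡ ⟦ adj G x y ⟧ + degIn G A x
degIn-insert G A x y y∉A =
  trans (sym (+-identityʳ _)) (∑-insert A y y∉A λ b t → ⟦ t ∧ adj G x b ⟧)

degOut-insert : ∀ {n} (G : Graph n) (A : Sub n) x y → lookup A y ≡ false →
  degOut G (A [ y ]≔ true) x + ⟦ adj G x y ⟧ ≡ degOut G A x
degOut-insert G A x y y∉A = ∑-insert A y y∉A λ b t → ⟦ not t ∧ adj G x b ⟧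

cut-insert : ∀ {n} (G : Graph n) (A : Sub n) x → lookup A x ≡ false →
  cut G (A [ x ]≔ true) + degIn G A x ≡ degOut G A x + cut G A
cut-insert {n} G A x x∉A = begin
  cut G A⁺ + degIn G A x
    ≡⟨ cong (_+ degIn G A x)
         (trans (sym (+-identityʳ _)) (∑-insert A x x∉A λ a t → if t then degOut G A⁺ a else 0)) ⟩
  degOut G A⁺ x + ∑[ a < n ] (if lookup A a then degOut G A⁺ a else 0) + degIn G A x
    ≡⟨ +-assoc (degOut G A⁺ x) _ _ ⟩
  degOut G A⁺ x + (∑[ a < n ] (if lookup A a then degOut G A⁺ a else 0) + degIn G A x)
    ≡⟨ cong₂ _+_ loop (sym (∑-distrib-+ {n} _ _)) ⟩
  degOut G A x + ∑[ a < n ] ((if lookup A a then degOut G A⁺ a else 0) + ⟦ lookup A a ∧ adj G x a ⟧)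
    ≡⟨ cong (degOut G A x +_) (sum-cong-≗ {n} λ a → leaves a (lookup A a)) ⟩
  degOut G A x + cut G A ∎
  where
  open ≡-Reasoning
  A⁺ = A [ x ]≔ true
  loop : degOut G A⁺ x ≡ degOut G A x
  loop = begin
    degOut G A⁺ x                  ≡⟨ sym (+-identityʳ _) ⟩
    degOut G A⁺ x + ⟦ false ⟧      ≡⟨ cong (λ t → degOut G A⁺ x + ⟦ t ⟧) (sym (irrefl G x)) ⟩
    degOut G A⁺ x + ⟦ adj G x x ⟧  ≡⟨ degOut-insert G A x x x∉A ⟩
    degOut G A x                   ∎
  leaves : ∀ a a∈A → (if a∈A then degOut G A⁺ a else 0) + ⟦ a∈A ∧ adj G x a ⟧
                     ≡ (if a∈A then degOut G A a else 0)
  leaves a true = trans (cong (λ t → degOut G A⁺ a + ⟦ t ⟧) (Graph.sym G x a)) (degOut-insert G A a x x∉A)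
  leaves a false = refl

deg-as-sum : ∀ {n} (G : Graph n) x → deg G x ≡ ∑[ b < n ] ⟦ adj G x b ⟧
deg-as-sum G x = countL-tabulate (adj G x) id

deg≡degIn+degOut : ∀ {n} (G : Graph n) (A : Sub n) x → deg G x ≡ degIn G A x + degOut G A x
deg≡degIn+degOut {n} G A x = trans (deg-as-sum G x) (trans (sum-cong-≗ {n} split) (∑-distrib-+ {n} _ _))
  where
  split : ∀ b → ⟦ adj G x b ⟧ ≡ ⟦ lookup A b ∧ adj G x b ⟧ + ⟦ not (lookup A b) ∧ adj G x b ⟧
  split b with lookup A b
  ... | true = sym (+-identityʳ _)
  ... | false = refl

cut-insert-deg : ∀ {n} (G : Graph n) (A : Sub n) x → lookup A x ≡ false →
  cut G (A [ x ]≔ true) + 2 * degIn G A x ≡ deg G x + cut G A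
cut-insert-deg G A x x∉A = begin
  cut G A⁺ + 2 * d                 ≡⟨ cong (cut G A⁺ +_) (cong (d +_) (+-identityʳ d)) ⟩
  cut G A⁺ + (d + d)               ≡⟨ sym (+-assoc (cut G A⁺) d d) ⟩
  cut G A⁺ + d + d                 ≡⟨ cong (_+ d) (cut-insert G A x x∉A) ⟩
  degOut G A x + cut G A + d       ≡⟨ xy∙z≈zx∙y (degOut G A x) (cut G A) d ⟩
  d + degOut G A x + cut G A       ≡⟨ cong (_+ cut G A) (sym (deg≡degIn+degOut G A x)) ⟩
  deg G x + cut G A                ∎
  where
  open ≡-Reasoning
  A⁺ = A [ x ]≔ true
  d = degIn G A x

degree-balance : ∀ {n} (G : Graph n) k → TokenRegular G k →
  ∀ (S : Sub n) u v → lookup S u ≡ false → lookup S v ≡ false → suc (size S) ≡ k →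
  deg G u + 2 * degIn G S v ≡ deg G v + 2 * degIn G S u
degree-balance G k (r , regular) S u v u∉S v∉S ∣S∣+1≡k = +-cancelʳ-≡ (cut G S) _ _ (begin
  deg G u + 2 * degIn G S v + cut G S  ≡⟨ xy∙z≈xz∙y (deg G u) _ (cut G S) ⟩
  deg G u + cut G S + 2 * degIn G S v  ≡⟨ cong (_+ 2 * degIn G S v) (sym (after u u∉S)) ⟩
  r + 2 * degIn G S u + 2 * degIn G S v ≡⟨ xy∙z≈xz∙y r _ _ ⟩
  r + 2 * degIn G S v + 2 * degIn G S u ≡⟨ cong (_+ 2 * degIn G S u) (after v v∉S) ⟩
  deg G v + cut G S + 2 * degIn G S u  ≡⟨ xy∙z≈xz∙y (deg G v) _ _ ⟩
  deg G v + 2 * degIn G S u + cut G S  ∎)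
  where
  open ≡-Reasoning
  after : ∀ x → lookup S x ≡ false → r + 2 * degIn G S x ≡ deg G x + cut G S
  after x x∉S = trans (cong (_+ 2 * degIn G S x) (sym cut≡r)) (cut-insert-deg G S x x∉S)
    where
    S⁺ = S [ x ]≔ true
    ∣S⁺∣≡k : size S⁺ ≡ k
    ∣S⁺∣≡k = trans (size-insert S x x∉S) ∣S∣+1≡k
    cut≡r : cut G S⁺ ≡ r
    cut≡r = trans (sym (tokDeg≡cut G S⁺)) (trans (cong (λ m → tokDeg G m S⁺) ∣S⁺∣≡k) (regular S⁺ ∣S⁺∣≡k))

-- Sets of prescribed size

subset-of-size : ∀ {n} (Y : Sub n) m → m ≤ size Y →
  ∃ λ (X : Sub n) → size X ≡ m × (∀ i → lookup Y i ≡ false → lookup X i ≡ false)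
subset-of-size [] zero _ = [] , refl , λ ()
subset-of-size (y ∷ Y) zero _ with subset-of-size Y zero z≤n
... | X , ∣X∣≡0 , X⊆Y = false ∷ X , ∣X∣≡0 , λ { zero _ → refl ; (suc i) → X⊆Y i }
subset-of-size (true ∷ Y) (suc m) (s≤s m≤∣Y∣) with subset-of-size Y m m≤∣Y∣
... | X , ∣X∣≡m , X⊆Y = true ∷ X , cong suc ∣X∣≡m , λ { (suc i) → X⊆Y i }
subset-of-size (false ∷ Y) (suc m) m<∣Y∣ with subset-of-size Y (suc m) m<∣Y∣
... | X , ∣X∣≡m , X⊆Y = false ∷ X , ∣X∣≡m , λ { zero _ → refl ; (suc i) → X⊆Y i }

size-⊤ : ∀ n → size (⊤ {n}) ≡ n
size-⊤ zero = refl
size-⊤ (suc n) = cong suc (size-⊤ n)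

size-remove : ∀ {n} (A : Sub n) x → size A ≤ suc (size (A [ x ]≔ false))
size-remove (true ∷ A) zero = ≤-refl
size-remove (false ∷ A) zero = n≤1+n (size A)
size-remove (true ∷ A) (suc x) = s≤s (size-remove A x)
size-remove (false ∷ A) (suc x) = size-remove A x

remove-preserves-∉ : ∀ {n} (A : Sub n) x y → lookup A y ≡ false → lookup (A [ x ]≔ false) y ≡ false
remove-preserves-∉ A x y y∉A with y Fin.≟ x
... | yes refl = lookup∘update y A false
... | no y≢x = trans (lookup∘update′ y≢x A false) y∉A

avoiding : ∀ {n} → List (Fin n) → Sub n
avoiding [] = ⊤
avoiding (x ∷ xs) = avoiding xs [ x ]≔ false

size-avoiding : ∀ {n} (xs : List (Fin n)) → n ≤ size (avoiding xs) + length xs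
size-avoiding {n} [] = ≤-reflexive (sym (trans (+-identityʳ _) (size-⊤ n)))
size-avoiding (x ∷ xs) = begin
  _                                          ≤⟨ size-avoiding xs ⟩
  size (avoiding xs) + length xs             ≤⟨ +-monoˡ-≤ (length xs) (size-remove (avoiding xs) x) ⟩
  suc (size (avoiding (x ∷ xs))) + length xs ≡⟨ sym (+-suc _ (length xs)) ⟩
  size (avoiding (x ∷ xs)) + length (x ∷ xs) ∎
  where open ≤-Reasoning

avoiding-∉ : ∀ {n} (xs : List (Fin n)) → All (λ x → lookup (avoiding xs) x ≡ false) xs
avoiding-∉ [] = []
avoiding-∉ (x ∷ xs) = lookup∘update x (avoiding xs) false
                    ∷ All.map (remove-preserves-∉ (avoiding xs) x _) (avoiding-∉ xs)

subset-avoiding : ∀ {n} (xs : List (Fin n)) m → m + length xs ≤ n →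
  ∃ λ (S : Sub n) → size S ≡ m × All (λ x → lookup S x ≡ false) xs
subset-avoiding xs m m+∣xs∣≤n with subset-of-size (avoiding xs) m
  (+-cancelʳ-≤ (length xs) m _ (≤-trans m+∣xs∣≤n (size-avoiding xs)))
... | S , ∣S∣≡m , S⊆Y = S , ∣S∣≡m , All.map (S⊆Y _) (avoiding-∉ xs)

-- Neighbours separating u from v

member≢nonmember : ∀ {n} (A : Sub n) {a b} → lookup A a ≡ true → lookup A b ≡ false → a ≢ b
member≢nonmember A a∈A b∉A refl with trans (sym a∈A) b∉A
... | ()

balance-difference : ∀ du dv p q x y x′ y′ → du + 2 * (x + p) ≡ dv + 2 * (y + q) →
  du + 2 * (x′ + p) ≡ dv + 2 * (y′ + q) → x + y′ ≡ x′ + y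
balance-difference du dv p q x y x′ y′ h h′ = *-cancelˡ-≡ (x + y′) (x′ + y) 2 (+-cancelʳ-≡ K _ _ (begin
  2 * (x + y′) + K                          ≡⟨ sym (regroup du dv p q x y′) ⟩
  (du + 2 * (x + p)) + (dv + 2 * (y′ + q))   ≡⟨ cong₂ _+_ h (sym h′) ⟩
  (dv + 2 * (y + q)) + (du + 2 * (x′ + p))   ≡⟨ regroup′ du dv p q x′ y ⟩
  2 * (x′ + y) + K                          ∎))
  where
  open ≡-Reasoning
  K = du + dv + 2 * (p + q)
  regroup : ∀ a b c d e f → (a + 2 * (e + c)) + (b + 2 * (f + d)) ≡ 2 * (e + f) + (a + b + 2 * (c + d))
  regroup = solve-∀
  regroup′ : ∀ a b c d e f → (b + 2 * (f + d)) + (a + 2 * (e + c)) ≡ 2 * (e + f) + (a + b + 2 * (c + d))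
  regroup′ = solve-∀

separating-neighbour : ∀ {n} (G : Graph n) k u v → TokenRegular G (suc k) → k + 2 ≤ n →
  deg G u < deg G v → ∃ λ z → z ≢ u × z ≢ v × adj G v z ≡ true × adj G u z ≡ false
separating-neighbour {n} G k u v regular k+2≤n du<dv with subset-avoiding (u ∷ v ∷ []) k k+2≤n
... | S , ∣S∣≡k , u∉S ∷ v∉S ∷ []
  with Fin.any? (λ z → ¬? (z Fin.≟ u) ×-dec ¬? (z Fin.≟ v) ×-dec adj G v z ≟ᵇ true ×-dec adj G u z ≟ᵇ false)
...   | yes separating = separating
...   | no none = ⊥-elim (<-irrefl (degree-balance G (suc k) regular S u v u∉S v∉S (cong suc ∣S∣≡k))
                    (+-mono-<-≤ du<dv (*-monoʳ-≤ 2 (∑-mono-≤ {n} fewer))))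
  where
  fewer : ∀ b → ⟦ lookup S b ∧ adj G v b ⟧ ≤ ⟦ lookup S b ∧ adj G u b ⟧
  fewer b with lookup S b in b∈S | adj G v b in vb | adj G u b in ub
  ... | false | _ | _ = z≤n
  ... | true | false | _ = z≤n
  ... | true | true | true = ≤-refl
  ... | true | true | false =
    ⊥-elim (none (b , member≢nonmember S b∈S u∉S , member≢nonmember S b∈S v∉S , vb , ub))

adjacent-to-all-others : ∀ {n} (G : Graph n) k u v z → TokenRegular G (suc (suc k)) → k + 4 ≤ n →
  z ≢ u → z ≢ v → adj G v z ≡ true → adj G u z ≡ false →
  ∀ w → w ≢ u → w ≢ v → adj G v w ≡ true
adjacent-to-all-others G k u v z regular k+4≤n z≢u z≢v vz ¬uz w w≢u w≢v
  with subset-avoiding (u ∷ v ∷ w ∷ z ∷ []) k k+4≤n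
... | T , ∣T∣≡k , u∉T ∷ v∉T ∷ w∉T ∷ z∉T ∷ [] = ⟦⟧≡1+⇒true (trans (sym (+-identityʳ _)) difference)
  where
  ⟦⟧≡1+⇒true : ∀ {b c} → ⟦ b ⟧ ≡ suc c → b ≡ true
  ⟦⟧≡1+⇒true {true} _ = refl
  balance-with : ∀ y → lookup T y ≡ false → y ≢ u → y ≢ v →
    deg G u + 2 * (⟦ adj G v y ⟧ + degIn G T v) ≡ deg G v + 2 * (⟦ adj G u y ⟧ + degIn G T u)
  balance-with y y∉T y≢u y≢v = subst₂ (λ a b → deg G u + 2 * a ≡ deg G v + 2 * b)
    (degIn-insert G T v y y∉T) (degIn-insert G T u y y∉T)
    (degree-balance G _ regular (T [ y ]≔ true) u v
      (trans (lookup∘update′ (y≢u ∘ sym) T true) u∉T) (trans (lookup∘update′ (y≢v ∘ sym) T true) v∉T)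
      (cong suc (trans (size-insert T y y∉T) (cong suc ∣T∣≡k))))
  difference : ⟦ adj G v w ⟧ + 0 ≡ 1 + ⟦ adj G u w ⟧
  difference = balance-difference (deg G u) (deg G v) (degIn G T v) (degIn G T u) _ _ 1 0
    (balance-with w w∉T w≢u w≢v)
    (subst₂ (λ a b → deg G u + 2 * (⟦ a ⟧ + degIn G T v) ≡ deg G v + 2 * (⟦ b ⟧ + degIn G T u))
      vz ¬uz (balance-with z z∉T z≢u z≢v))

lemma3 : ∀ {n} (G : Graph n) (u v : Fin n) (k : ℕ) →
    ¬ Regular G → deg G u < deg G v →
    2 ≤ k → k ≤ n ∸ 2 → TokenRegular G k →
    ∀ (w : Fin n) → w ≢ u → w ≢ v → adj G v w ≡ true
lemma3 {n} G u v .(suc (suc m)) _ du<dv 2≤k@(s≤s (s≤s (z≤n {m}))) k≤n∸2 regular w w≢u w≢v =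
  let z , z≢u , z≢v , vz , ¬uz = separating-neighbour G (suc m) u v regular (≤-trans (n≤1+n _) k+2≤n) du<dv
  in adjacent-to-all-others G m u v z regular m+4≤n z≢u z≢v vz ¬uz w w≢u w≢v
  where
  k+2≤n : suc (suc m) + 2 ≤ n
  k+2≤n = m≤o∸n⇒m+n≤o (suc (suc m)) (≤-trans 2≤k (≤-trans k≤n∸2 (m∸n≤m n 2))) k≤n∸2
  m+4≤n : m + 4 ≤ n
  m+4≤n = subst (_≤ n) (sym (trans (+-suc m 3) (cong suc (+-suc m 2)))) k+2≤n
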